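{- Let $r\ge 2$ and $n\ge r+1$ be integers, let $S\subseteq[n]$ with $|S|=r+1$, and let $b\in\{0,1\}^{[n]\setminus S}$ be an offset. Let $\sigma\subseteq Q_{r+1}^b$ be such that $\pi_S(\sigma)\in\mathcal{A}_r$. If $\mathrm{localDiam}(\sigma,w)=r$ for all $w\in\sigma$, then $\sigma$ is a maximal simplex of $\mathrm{VR}(Q_n;r)$.
   Context: $Q_n$ denotes $\{0,1\}^n$ with the $\ell^1$ (Hamming) metric $d$. $\mathrm{VR}(X;r)$ is the simplicial complex on vertex set $X$ whose simplices are finite subsets of diameter at most $r$; a maximal simplex is one not properly contained in another simplex. For $S=\{s_1<\dots<s_p\}\subseteq[n]$ and offset $b\in\{0,1\}^{[n]\setminus S}$, $Q_p^b=\{x\in Q_n: x_i=b_i \text{ for all } i\notin S\}$, and $\pi_S\colon Q_n\to Q_p$, $x\mapsto (x_{s_1},\dots,x_{s_p})$. For $a\in Q_m$, its antipode is $\bar a=(1,\dots,1)-a$. $\mathcal{A}_r=\{Y\subseteq Q_{r+1} : \text{for all } x\in Q_{r+1},\ x\in Y \iff \bar x\notin Y\}$. For finite $A$ and $a\in A$, $\mathrm{localDiam}(A,a)=\max_{b\in A} d(a,b)$. -}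

module Defs where

open import Data.Bool using (Bool; true; false; not; _xor_)
open import Data.Nat using (ℕ; zero; suc; _+_; _≤_)
open import Data.Fin using (Fin)
open import Data.Vec using (Vec; []; _∷_; map; lookup)
open import Data.Fin.Subset using (Subset; ∣_∣; _∉_)
open import Data.Product using (Σ; _×_; ∃)
open import Relation.Binary.PropositionalEquality using (_≡_; subst)
open import Relation.Nullary using (¬_)
open import Function.Bundles using (_⇔_)

Q : ℕ → Set
Q n = Vec Bool n

d : ∀ {n} → Q n → Q n → ℕ
d []       []       = 0
d (x ∷ xs) (y ∷ ys) = (if-xor x y) + d xs ys
  where
  if-xor : Bool → Bool → ℕ
  if-xor a b with a xor b
  ... | true  = 1
  ... | false = 0

-- (Decidable, hence finite) subsets of Q_n, given by characteristic functions.
PointSet : ℕ → Set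
PointSet n = Q n → Bool

_∈ₚ_ : ∀ {n} → Q n → PointSet n → Set
x ∈ₚ σ = σ x ≡ true

_⊆ₚ_ : ∀ {n} → PointSet n → PointSet n → Set
σ ⊆ₚ τ = ∀ x → x ∈ₚ σ → x ∈ₚ τ

IsVRSimplex : ∀ {n} → ℕ → PointSet n → Set
IsVRSimplex r τ = ∀ x y → x ∈ₚ τ → y ∈ₚ τ → d x y ≤ r

IsMaximalVRSimplex : ∀ {n} → ℕ → PointSet n → Set
IsMaximalVRSimplex r σ =
  IsVRSimplex r σ × (∀ τ → IsVRSimplex r τ → σ ⊆ₚ τ → τ ⊆ₚ σ)

LocalDiamIs : ∀ {n} → PointSet n → Q n → ℕ → Set
LocalDiamIs A a k = (∀ b → b ∈ₚ A → d a b ≤ k) × (Σ (Q _) λ b → b ∈ₚ A × d a b ≡ k)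

InSubcube : ∀ {n} (S : Subset n) → ((i : Fin n) → i ∉ S → Bool) → Q n → Set
InSubcube {n} S b x = ∀ (i : Fin n) → (h : i ∉ S) → lookup x i ≡ b i h

π : ∀ {n} (S : Subset n) → Q n → Q ∣ S ∣
π []          []       = []
π (true ∷ S)  (x ∷ xs) = x ∷ π S xs
π (false ∷ S) (x ∷ xs) = π S xs

image : ∀ {n} (S : Subset n) → PointSet n → Q ∣ S ∣ → Set
image S σ y = Σ (Q _) λ x → x ∈ₚ σ × π S x ≡ y

antipode : ∀ {m} → Q m → Q m
antipode = map not

InA : (r : ℕ) → (Q (suc r) → Set) → Set
InA r Y = ∀ x → Y x ⇔ (¬ Y (antipode x))

{-# OPTIONS --safe #-}
module Submission where

-- σ has diameter r, so it is a simplex; let z lie in a simplex τ ⊇ σ.  The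
-- antipode of π_S z cannot lie in π_S(σ), since any x ∈ σ over it would satisfy
-- d(z, x) ≥ |S| = r + 1; hence π_S z ∈ π_S(σ) because π_S(σ) ∈ 𝒜_r, say
-- π_S z = π_S x with x ∈ σ.  Pick x' ∈ σ with d(x, x') = r.  The points of σ
-- agree off S, so d(z, x') = d(x, x') + d_{[n]∖S}(z, x) = r + d_{[n]∖S}(z, x);
-- as d(z, x') ≤ r, z agrees with x off S as well, and z = x ∈ σ.

open import Defs
open import Data.Bool using (Bool; true; false)
open import Data.Nat using (ℕ; zero; suc; _+_; _≤_)
open import Data.Nat.Properties
  using (+-assoc; +-identityʳ; m≤m+n; ≤⇒≯; m+1+n≰m; +-commutativeSemigroup)
open import Algebra.Properties.CommutativeSemigroup +-commutativeSemigroup using (x∙yz≈y∙xz)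
open import Data.Fin using (Fin) renaming (zero to fzero; suc to fsuc)
open import Data.Fin.Subset using (Subset; ∣_∣; _∉_; ∁)
open import Data.Vec using ([]; _∷_; [_]; lookup)
open import Data.Vec.Base using (_[_]=_)
open import Data.Product using (_,_; proj₁)
open import Data.Empty using (⊥-elim)
open import Relation.Nullary using (¬_)
open import Function.Bundles using (Equivalence)
open import Relation.Binary.PropositionalEquality
  using (_≡_; refl; sym; trans; cong; cong₂; subst; module ≡-Reasoning)

open _[_]=_
open ≡-Reasoning

d-∷ : ∀ {n} x y (xs ys : Q n) → d (x ∷ xs) (y ∷ ys) ≡ d [ x ] [ y ] + d xs ys
d-∷ true  true  _ _ = refl
d-∷ true  false _ _ = refl
d-∷ false true  _ _ = refl
d-∷ false false _ _ = refl

d-self : ∀ {n} (x : Q n) → d x x ≡ 0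
d-self []          = refl
d-self (true  ∷ x) = d-self x
d-self (false ∷ x) = d-self x

d≡0⇒≡ : ∀ {n} (x y : Q n) → d x y ≡ 0 → x ≡ y
d≡0⇒≡ []          []          _  = refl
d≡0⇒≡ (true  ∷ x) (true  ∷ y) eq = cong (true ∷_) (d≡0⇒≡ x y eq)
d≡0⇒≡ (false ∷ x) (false ∷ y) eq = cong (false ∷_) (d≡0⇒≡ x y eq)
d≡0⇒≡ (true  ∷ x) (false ∷ y) ()
d≡0⇒≡ (false ∷ x) (true  ∷ y) ()

d-antipode : ∀ {n} (x : Q n) → d x (antipode x) ≡ n
d-antipode []          = refl
d-antipode (true  ∷ x) = cong suc (d-antipode x)
d-antipode (false ∷ x) = cong suc (d-antipode x)

d-π-split : ∀ {n} (S : Subset n) (x y : Q n) →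
            d x y ≡ d (π S x) (π S y) + d (π (∁ S) x) (π (∁ S) y)
d-π-split []          []       []       = refl
d-π-split (true ∷ S)  (x ∷ xs) (y ∷ ys) = begin
  d (x ∷ xs) (y ∷ ys)                                               ≡⟨ d-∷ x y xs ys ⟩
  d [ x ] [ y ] + d xs ys                                           ≡⟨ cong (d [ x ] [ y ] +_) (d-π-split S xs ys) ⟩
  d [ x ] [ y ] + (d (π S xs) (π S ys) + d (π (∁ S) xs) (π (∁ S) ys)) ≡⟨ sym (+-assoc (d [ x ] [ y ]) (d (π S xs) (π S ys)) _) ⟩
  (d [ x ] [ y ] + d (π S xs) (π S ys)) + d (π (∁ S) xs) (π (∁ S) ys) ≡⟨ cong (_+ d (π (∁ S) xs) (π (∁ S) ys)) (sym (d-∷ x y (π S xs) (π S ys))) ⟩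
  d (x ∷ π S xs) (y ∷ π S ys) + d (π (∁ S) xs) (π (∁ S) ys)         ∎
d-π-split (false ∷ S) (x ∷ xs) (y ∷ ys) = begin
  d (x ∷ xs) (y ∷ ys)                                               ≡⟨ d-∷ x y xs ys ⟩
  d [ x ] [ y ] + d xs ys                                           ≡⟨ cong (d [ x ] [ y ] +_) (d-π-split S xs ys) ⟩
  d [ x ] [ y ] + (d (π S xs) (π S ys) + d (π (∁ S) xs) (π (∁ S) ys)) ≡⟨ x∙yz≈y∙xz (d [ x ] [ y ]) (d (π S xs) (π S ys)) _ ⟩
  d (π S xs) (π S ys) + (d [ x ] [ y ] + d (π (∁ S) xs) (π (∁ S) ys)) ≡⟨ cong (d (π S xs) (π S ys) +_) (sym (d-∷ x y (π (∁ S) xs) (π (∁ S) ys))) ⟩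
  d (π S xs) (π S ys) + d (x ∷ π (∁ S) xs) (y ∷ π (∁ S) ys)         ∎

d-π≤d : ∀ {n} (S : Subset n) (x y : Q n) → d (π S x) (π S y) ≤ d x y
d-π≤d S x y = subst (d (π S x) (π S y) ≤_) (sym (d-π-split S x y)) (m≤m+n _ _)

π-∁-injective : ∀ {n} (S : Subset n) (x y : Q n) →
                π S x ≡ π S y → π (∁ S) x ≡ π (∁ S) y → x ≡ y
π-∁-injective S x y πx≡πy π∁x≡π∁y = d≡0⇒≡ x y (begin
  d x y                                             ≡⟨ d-π-split S x y ⟩
  d (π S x) (π S y) + d (π (∁ S) x) (π (∁ S) y)     ≡⟨ cong₂ _+_ (cong (d (π S x)) (sym πx≡πy))
                                                                 (cong (d (π (∁ S) x)) (sym π∁x≡π∁y)) ⟩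
  d (π S x) (π S x) + d (π (∁ S) x) (π (∁ S) x)     ≡⟨ cong₂ _+_ (d-self (π S x)) (d-self (π (∁ S) x)) ⟩
  0                                                 ∎)

agree-off⇒π-∁-≡ : ∀ {n} (S : Subset n) (x y : Q n) →
                  (∀ i → i ∉ S → lookup x i ≡ lookup y i) → π (∁ S) x ≡ π (∁ S) y
agree-off⇒π-∁-≡ []          []       []       _     = refl
agree-off⇒π-∁-≡ (true ∷ S)  (x ∷ xs) (y ∷ ys) agree =
  agree-off⇒π-∁-≡ S xs ys (λ i i∉S → agree (fsuc i) λ { (there i∈S) → i∉S i∈S })
agree-off⇒π-∁-≡ (false ∷ S) (x ∷ xs) (y ∷ ys) agree =
  cong₂ _∷_ (agree fzero λ ()) (agree-off⇒π-∁-≡ S xs ys (λ i i∉S → agree (fsuc i) λ { (there i∈S) → i∉S i∈S }))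

∣S∣≤d-of-antipodal-projections : ∀ {n} (S : Subset n) (x y : Q n) →
                                 π S y ≡ antipode (π S x) → ∣ S ∣ ≤ d x y
∣S∣≤d-of-antipodal-projections S x y πy≡π̄x =
  subst (_≤ d x y) (trans (cong (d (π S x)) πy≡π̄x) (d-antipode (π S x))) (d-π≤d S x y)

d-through-twin : ∀ {n} (S : Subset n) (z x x' : Q n) →
                 π S z ≡ π S x → π (∁ S) x ≡ π (∁ S) x' →
                 d z x' ≡ d x x' + d (π (∁ S) z) (π (∁ S) x)
d-through-twin S z x x' πz≡πx π∁x≡π∁x' = begin
  d z x'                                                ≡⟨ d-π-split S z x' ⟩
  d (π S z) (π S x') + d (π (∁ S) z) (π (∁ S) x')       ≡⟨ cong₂ _+_ (cong (λ p → d p (π S x')) πz≡πx)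
                                                                     (cong (d (π (∁ S) z)) (sym π∁x≡π∁x')) ⟩
  d (π S x) (π S x') + d (π (∁ S) z) (π (∁ S) x)        ≡⟨ cong (_+ _) (sym d-πx-x') ⟩
  d x x' + d (π (∁ S) z) (π (∁ S) x)                    ∎
  where
  d-πx-x' : d x x' ≡ d (π S x) (π S x')
  d-πx-x' = begin
    d x x'                                              ≡⟨ d-π-split S x x' ⟩
    d (π S x) (π S x') + d (π (∁ S) x) (π (∁ S) x')     ≡⟨ cong (λ p → d (π S x) (π S x') + d p (π (∁ S) x')) π∁x≡π∁x' ⟩
    d (π S x) (π S x') + d (π (∁ S) x') (π (∁ S) x')    ≡⟨ cong (d (π S x) (π S x') +_) (d-self (π (∁ S) x')) ⟩
    d (π S x) (π S x') + 0                              ≡⟨ +-identityʳ _ ⟩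
    d (π S x) (π S x')                                  ∎

collapse-onto-twin : ∀ {n r} (S : Subset n) (z x x' : Q n) →
                     π S z ≡ π S x → π (∁ S) x ≡ π (∁ S) x' →
                     d x x' ≡ r → d z x' ≤ r → z ≡ x
collapse-onto-twin {r = r} S z x x' πz≡πx π∁x≡π∁x' dxx'≡r dzx'≤r =
  π-∁-injective S z x πz≡πx (d≡0⇒≡ _ _ (r+k≤r⇒k≡0 _ r+k≤r))
  where
  r+k≤r : r + d (π (∁ S) z) (π (∁ S) x) ≤ r
  r+k≤r = subst (_≤ r) (trans (d-through-twin S z x x' πz≡πx π∁x≡π∁x') (cong (_+ _) dxx'≡r)) dzx'≤r

  r+k≤r⇒k≡0 : ∀ k → r + k ≤ r → k ≡ 0
  r+k≤r⇒k≡0 zero    _ = refl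
  r+k≤r⇒k≡0 (suc k) h = ⊥-elim (m+1+n≰m r h)

InA-¬antipode⇒∈ : ∀ r {m} (hS : m ≡ suc r) (Y : Q m → Set) →
                  InA r (subst (λ k → Q k → Set) hS Y) → ∀ y → ¬ Y (antipode y) → Y y
InA-¬antipode⇒∈ r refl Y Y∈𝒜 y = Equivalence.from (Y∈𝒜 y)

mainTheorem9 : (r n : ℕ) → 2 ≤ r → suc r ≤ n
    → (S : Subset n) → (hS : ∣ S ∣ ≡ suc r)
    → (b : (i : Fin n) → i ∉ S → Bool)
    → (σ : PointSet n)
    → (∀ x → x ∈ₚ σ → InSubcube S b x)
    → InA r (subst (λ m → Q m → Set) hS (image S σ))
    → (∀ w → w ∈ₚ σ → LocalDiamIs σ w r)
    → IsMaximalVRSimplex r σ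
mainTheorem9 r n _ _ S hS b σ σ⊆Qᵇ πσ∈𝒜 localDiam = isSimplex , isMaximal
  where
  isSimplex : IsVRSimplex r σ
  isSimplex x y x∈σ = proj₁ (localDiam x x∈σ) y

  isMaximal : ∀ τ → IsVRSimplex r τ → σ ⊆ₚ τ → τ ⊆ₚ σ
  isMaximal τ τ-simplex σ⊆τ z z∈τ with InA-¬antipode⇒∈ r hS (image S σ) πσ∈𝒜 (π S z) antipode∉πσ
    where
    antipode∉πσ : ¬ image S σ (antipode (π S z))
    antipode∉πσ (x , x∈σ , πx≡π̄z) =
      ≤⇒≯ (τ-simplex z x z∈τ (σ⊆τ x x∈σ))
          (subst (_≤ d z x) hS (∣S∣≤d-of-antipodal-projections S z x πx≡π̄z))
  ... | x , x∈σ , πx≡πz with localDiam x x∈σ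
  ...   | _ , x' , x'∈σ , dxx'≡r =
    subst (_∈ₚ σ) (sym z≡x) x∈σ
    where
    π∁x≡π∁x' : π (∁ S) x ≡ π (∁ S) x'
    π∁x≡π∁x' = agree-off⇒π-∁-≡ S x x' λ i i∉S → trans (σ⊆Qᵇ x x∈σ i i∉S) (sym (σ⊆Qᵇ x' x'∈σ i i∉S))

    z≡x : z ≡ x
    z≡x = collapse-onto-twin S z x x' (sym πx≡πz) π∁x≡π∁x' dxx'≡r (τ-simplex z x' z∈τ (σ⊆τ x' x'∈σ))
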